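{- Let $\Bbbk$ be a field of characteristic different from $2$ and $n\ge0$. For each $i=0,\dots,n$, $\varphi(\mathfrak{I}_n^i)=\mathfrak{P}_n^{\lfloor i/2\rfloor}$.
   Context: $[m,n]=\{m,\dots,n\}$, $[n]=[1,n]$, $J+i=\{x+i:x\in J\}$. $B_n$ is the group of signed permutations (bijections $\sigma$ of $\{\pm1,\dots,\pm n\}$ with $\sigma(-i)=-\sigma(i)$); $\sigma(0)=0$, $\mathrm{Des}(\sigma)=\{i\in[0,n-1]:\sigma(i)>\sigma(i+1)\}$. For $J\subseteq[0,n-1]$, $X_J=\sum_{\mathrm{Des}(\sigma)\subseteq J}\sigma$; $\Sigma(B_n)$ is the span of the $X_J$. A pseudocomposition $\beta=(b_0,\dots,b_k)$ of $n$ (integers, $b_0\ge0$, $b_i\ge1$ for $i\ge1$, sum $n$) has $J(\beta)=\{b_0,b_0+b_1,\dots,b_0+\dots+b_{k-1}\}$, and $X_\beta:=X_{J(\beta)}$. $\beta_m:\Sigma(B_m)\to\Sigma(B_{m-1})$ ($m\ge1$) is linear with $X_{(b_0,\dots,b_k)}\mapsto X_{(b_0-1,b_1,\dots,b_k)}$ if $b_0\ne0$, $\mapsto0$ if $b_0=0$; $\beta_0=0$. $\mathfrak{I}_n^i=\ker(\beta_{n-i}\circ\dots\circ\beta_n)$. $\varphi:\Bbbk B_n\to\Bbbk S_n$ is the linear extension of $\varphi(\sigma)(i)=|\sigma(i)|$. Peak algebra: sparse sets have no two consecutive integers; for $\sigma\in S_n$, $\sigma(0)=0$, $\mathrm{Peak}(\sigma)=\{i\in[n-1]:\sigma(i-1)<\sigma(i)>\sigma(i+1)\}$;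 $P_F=\sum_{\mathrm{Peak}(\sigma)=F}\sigma$ for sparse $F\subseteq[n-1]$; $\mathfrak{P}_n$ is the span of the $P_F$. $\pi_m:\mathfrak{P}_m\to\mathfrak{P}_{m-2}$ ($m\ge2$) is linear with $P_F\mapsto-P_{(F\setminus\{1\})-2}$ if $1\in F$, $0$ if $2\in F$, $P_{F-2}$ if $1,2\notin F$; $\pi_1,\pi_0$ are zero. $\mathfrak{P}_n^j=\ker(\pi_{n-2j}\circ\dots\circ\pi_{n-2}\circ\pi_n)$ for $j=0,\dots,\lfloor n/2\rfloor$. -}

module Defs where

open import Level using (Level; _⊔_) renaming (suc to lsuc)
open import Algebra.Bundles using (CommutativeRing)
open import Data.Nat as ℕ using (ℕ; zero; suc; _<?_)
open import Data.Fin as Fin using (Fin; toℕ; fromℕ<)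
open import Data.Fin.Permutation using (Permutation′; _⟨$⟩ʳ_)
open import Data.Integer as ℤ using (ℤ; +_; -[1+_])
open import Data.Bool using (Bool; true; false; if_then_else_; _∧_; not)
open import Data.Vec as Vec using (Vec; []; _∷_; lookup)
import Data.Vec.Properties as VecP
open import Data.List as List using (List; []; _∷_; _++_)
open import Data.Product using (Σ; _×_; _,_; ∃)
open import Data.Unit using (⊤)
open import Relation.Nullary using (¬_; does)

record Field (c ℓ : Level) : Set (lsuc (c ⊔ ℓ)) where
  field
    commutativeRing : CommutativeRing c ℓ
  open CommutativeRing commutativeRing public
  field
    1≉0     : ¬ (1# ≈ 0#)
    inverse : ∀ x → ¬ (x ≈ 0#) → ∃ λ y → x * y ≈ 1#

CharNot2 : ∀ {c ℓ} → Field c ℓ → Set ℓ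
CharNot2 F = ¬ (1# + 1# ≈ 0#) where open Field F

-- Subsets of {0,…,n-1} as boolean vectors (index k ↦ is k an element?)

Subset : ℕ → Set
Subset n = Vec Bool n

allSubsets : (n : ℕ) → List (Subset n)
allSubsets zero    = [] ∷ []
allSubsets (suc n) = List.map (false ∷_) (allSubsets n) ++ List.map (true ∷_) (allSubsets n)

_≟ₛ_ : ∀ {n} → Subset n → Subset n → Bool
A ≟ₛ B = does (VecP.≡-dec Data.Bool._≟_ A B)
  where import Data.Bool

_⊆ₛ_ : ∀ {n} → Subset n → Subset n → Bool
[]      ⊆ₛ []      = true
(a ∷ A) ⊆ₛ (b ∷ B) = (not a Data.Bool.∨ b) ∧ (A ⊆ₛ B)
  where import Data.Bool

-- Signed permutations.  σ ∈ B_n is encoded by a pair (τ , s) with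
-- τ ∈ S_n and s ∈ {±}^n:  σ(k+1) = -(τ(k)+1) if s[k] = true,
-- σ(k+1) = τ(k)+1 otherwise (positions/values shifted to Fin n).
-- This is a bijection B_n ≅ S_n × {±}^n, and φ(σ) = τ.

SignedPerm : ℕ → Set
SignedPerm n = Permutation′ n × Subset n

-- σ(i) for i ∈ [0,n], with σ(0) = 0 (junk 0 for i > n)
sval : ∀ {n} → SignedPerm n → ℕ → ℤ
sval σ zero = + 0
sval {n} (τ , s) (suc p) with p <? n
... | Relation.Nullary.yes p<n =
        let k = fromℕ< p<n in
        if lookup s k then -[1+ toℕ (τ ⟨$⟩ʳ k) ] else + suc (toℕ (τ ⟨$⟩ʳ k))
... | Relation.Nullary.no _ = + 0

Des : ∀ {n} → SignedPerm n → Subset n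
Des σ = Vec.tabulate λ k → does (sval σ (suc (toℕ k)) ℤ.<? sval σ (toℕ k))

pval : ∀ {n} → Permutation′ n → ℕ → ℕ
pval τ zero = 0
pval {n} τ (suc p) with p <? n
... | Relation.Nullary.yes p<n = suc (toℕ (τ ⟨$⟩ʳ fromℕ< p<n))
... | Relation.Nullary.no _ = 0

-- Peak(τ) ⊆ [n-1], as a subset of {0,…,n-1} (index 0 never a peak)
Peak : ∀ {n} → Permutation′ n → Subset n
Peak τ = Vec.tabulate λ k → peakAt (toℕ k)
  where
  peakAt : ℕ → Bool
  peakAt zero    = false
  peakAt (suc i) = does (pval τ i ℕ.<? pval τ (suc i)) ∧ does (pval τ (suc (suc i)) ℕ.<? pval τ (suc i))

-- F is an admissible peak-set index: F ⊆ [n-1] (0 ∉ F) and F is sparse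
noConsec : ∀ {n} → Subset n → Bool
noConsec []            = true
noConsec (a ∷ [])      = true
noConsec (a ∷ b ∷ A)   = not (a ∧ b) ∧ noConsec (b ∷ A)

admissible : ∀ {n} → Subset n → Bool
admissible []      = true
admissible (a ∷ A) = not a ∧ noConsec (a ∷ A)

module WithField {c ℓ} (F : Field c ℓ) where
  open Field F

  sumL : ∀ {A : Set} → List A → (A → Carrier) → Carrier
  sumL xs f = List.foldr (λ x acc → f x + acc) 0# xs

  -- Elements of Σ(B_n), given by their coefficients c_J in the basis X_J,
  -- J ⊆ [0,n-1] (J ↔ pseudocomposition β with J(β) = J).
  Coef : ℕ → Set c
  Coef n = Subset n → Carrier

  -- the element Σ_J c_J X_J of 𝕜B_n, as a function B_n → 𝕜
  elemB : (n : ℕ) → Coef n → SignedPerm n → Carrier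
  elemB n cf σ = sumL (allSubsets n) λ J → if Des σ ⊆ₛ J then cf J else 0#

  φ : (n : ℕ) → (SignedPerm n → Carrier) → Permutation′ n → Carrier
  φ n x τ = sumL (allSubsets n) λ s → x (τ , s)

  -- β_{m+1}(X_J) = X_{J-1} if 0 ∉ J (i.e. b₀ ≠ 0), and 0 if 0 ∈ J (b₀ = 0)
  βcoef : (m : ℕ) → Coef (suc m) → Coef m
  βcoef m cf J′ = sumL (allSubsets (suc m)) λ
    { (true  ∷ J) → 0#
    ; (false ∷ J) → if J ≟ₛ J′ then cf (false ∷ J) else 0# }

  -- killedB k m x : applying the k maps β_{m-k+1} ∘ … ∘ β_m to x gives 0
  -- (β₀ = 0).
  killedB : ℕ → (m : ℕ) → Coef m → Set ℓ
  killedB zero    m       cf = ∀ σ → elemB m cf σ ≈ 0#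
  killedB (suc k) zero    cf = Level.Lift ℓ ⊤
  killedB (suc k) (suc m) cf = killedB k m (βcoef m cf)

  -- x ∈ 𝔍_n^i = ker(β_{n-i} ∘ … ∘ β_n)
  In𝔍 : (n i : ℕ) → Coef n → Set ℓ
  In𝔍 n i cf = killedB (suc i) n cf

  -- Elements of 𝔓_n, given by coefficients d_F in the basis P_F
  -- (only admissible F are used)
  elemP : (n : ℕ) → Coef n → Permutation′ n → Carrier
  elemP n d τ = sumL (allSubsets n) λ G →
    if admissible G ∧ (Peak τ ≟ₛ G) then d G else 0#

  -- π_{m+2}:  P_F ↦ -P_{(F∖{1})-2} if 1 ∈ F,  0 if 2 ∈ F,  P_{F-2} otherwise
  contains2 : ∀ {m} → Subset m → Bool
  contains2 []      = false
  contains2 (a ∷ _) = a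

  πcoef : (m : ℕ) → Coef (suc (suc m)) → Coef m
  πcoef m d G = sumL (allSubsets (suc (suc m))) λ
    { (f0 ∷ f1 ∷ R) →
        if admissible (f0 ∷ f1 ∷ R) ∧ (R ≟ₛ G)
        then (if f1 then - d (f0 ∷ f1 ∷ R)
              else if contains2 R then 0# else d (f0 ∷ f1 ∷ R))
        else 0# }

  -- killedP k m y : applying the k maps π_{m-2k+2} ∘ … ∘ π_m gives 0
  -- (π₀ = π₁ = 0).
  killedP : ℕ → (m : ℕ) → Coef m → Set ℓ
  killedP zero    m             d = ∀ τ → elemP m d τ ≈ 0#
  killedP (suc k) zero          d = Level.Lift ℓ ⊤
  killedP (suc k) (suc zero)    d = Level.Lift ℓ ⊤
  killedP (suc k) (suc (suc m)) d = killedP k m (πcoef m d)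

  -- y ∈ 𝔓_n^j = ker(π_{n-2j} ∘ … ∘ π_{n-2} ∘ π_n)
  In𝔓 : (n j : ℕ) → Coef n → Set ℓ
  In𝔓 n j d = killedP (suc j) n d

{-# OPTIONS --safe #-}
module Submission where

-- Count the signings σ of τ ∈ Sₙ with Des σ ⊆ J from left to right: every
-- position outside J forces the sign of one neighbouring letter, and two such
-- constraints clash exactly at a peak of τ outside J ∪ (J + 1).  Hence
-- φ(X_J) = 2^|J| Σ_{Peak τ ⊆ J ∪ (J + 1)} τ, which expresses φ in the bases
-- (X_J) and (P_G).  In these coordinates π ∘ φ = φ ∘ β ∘ β, so φ(𝔍ⁱ) ⊆ 𝔓^⌊i/2⌋
-- by induction on i in steps of two.  Conversely, once 2 is invertible, φ has
-- an explicit right inverse on the span of the P_G, and a variant of it lifts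
-- ker π into ker β; a preimage of π y, shifted by two and corrected by such a
-- lift, is a preimage of y in 𝔍ⁱ.

open import Defs
open import Level using (lift)
open import Function using (_∘_)
open import Data.Nat using (ℕ; zero; suc; _≤_; _<?_; ⌊_/2⌋)
open import Data.Fin using (Fin; toℕ)
open import Data.Fin.Permutation using (Permutation′; _⟨$⟩ʳ_; id)
open import Data.Integer as ℤ using (ℤ; +_; -[1+_]; ∣_∣)
open import Data.Bool using (Bool; true; false; if_then_else_; _∧_; _∨_; not)
open import Data.Vec as Vec using (Vec; []; _∷_)
open import Data.List as List using (List; []; _∷_; _++_)
open import Data.Product using (_×_; _,_; ∃; proj₁; proj₂)
open import Data.Unit using (tt)
open import Relation.Nullary using (does)
open import Relation.Binary.PropositionalEquality using (_≡_)
import Relation.Binary.PropositionalEquality as ≡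

module Combinatorics where
  open ≡ using (_≢_; refl; sym; trans; cong; cong₂; module ≡-Reasoning)
  open import Data.Nat using (_+_)
  open import Data.Nat.Properties using (<-cmp; <-asym; +-suc; +-identityʳ; n<1+n; suc-injective)
  open import Data.Fin.Properties using (toℕ<n; fromℕ<-toℕ; toℕ-injective; 0≢1+n)
  import Data.Fin.Properties as FinP
  open import Data.Fin.Permutation using (lift₀; swap)
  open import Data.Vec using (lookup; tabulate; iterate)
  open import Data.Vec.Properties using (tabulate-∘; tabulate-cong; lookup∘tabulate)
  open import Data.Bool.Properties using (∨-zeroʳ)
  open import Data.Unit using (⊤)
  open import Data.Empty using (⊥-elim)
  open import Function.Bundles using (Injection)
  open import Function.Definitions using (Injective)
  open import Function.Properties.Inverse using (↔⇒↣)
  open import Relation.Nullary using (yes; no)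
  open import Relation.Nullary.Decidable using (dec-true; dec-false)
  open import Relation.Binary.Definitions using (tri<; tri≈; tri>)

  insert0 : ∀ {n} → Subset n → Subset n
  insert0 []      = []
  insert0 (_ ∷ G) = true ∷ G

  delete0 : ∀ {n} → Subset n → Subset n
  delete0 []      = []
  delete0 (_ ∷ G) = false ∷ G

  -- J ∪ (J + 1), cut off at n - 1
  withNext : ∀ {n} → Subset n → Subset n
  withNext []      = []
  withNext (j ∷ J) = j ∷ (if j then insert0 (withNext J) else withNext J)

  delete0-idem : ∀ {n} (G : Subset n) → delete0 (delete0 G) ≡ delete0 G
  delete0-idem []      = refl
  delete0-idem (_ ∷ G) = refl

  ⊆ₛ-insert0 : ∀ {n} (G H : Subset n) → (G ⊆ₛ insert0 H) ≡ (delete0 G ⊆ₛ H)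
  ⊆ₛ-insert0 []      []      = refl
  ⊆ₛ-insert0 (g ∷ G) (_ ∷ H) = cong (_∧ (G ⊆ₛ H)) (∨-zeroʳ (not g))

  ≟ₛ-sym : ∀ {n} (G H : Subset n) → (G ≟ₛ H) ≡ (H ≟ₛ G)
  ≟ₛ-sym []          []          = refl
  ≟ₛ-sym (false ∷ G) (false ∷ H) = ≟ₛ-sym G H
  ≟ₛ-sym (false ∷ G) (true  ∷ H) = refl
  ≟ₛ-sym (true  ∷ G) (false ∷ H) = refl
  ≟ₛ-sym (true  ∷ G) (true  ∷ H) = ≟ₛ-sym G H

  noConsec-tail : ∀ {n} a (G : Subset n) → noConsec (a ∷ G) ≡ true → noConsec G ≡ true
  noConsec-tail a     []          _  = refl
  noConsec-tail false (b ∷ G)     nc = nc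
  noConsec-tail true  (false ∷ G) nc = nc

  noConsec-delete0 : ∀ {n} (G : Subset n) → noConsec G ≡ true → noConsec (delete0 G) ≡ true
  noConsec-delete0 []          _  = refl
  noConsec-delete0 (a ∷ [])    _  = refl
  noConsec-delete0 (a ∷ b ∷ G) nc = noConsec-tail a (b ∷ G) nc

  noConsec-delete0-tail : ∀ {n} a (G : Subset n) → noConsec (a ∷ G) ≡ true → noConsec (delete0 G) ≡ true
  noConsec-delete0-tail a G nc = noConsec-delete0 G (noConsec-tail a G nc)

  delete0-after-true : ∀ {n} (G : Subset n) → noConsec (true ∷ G) ≡ true → delete0 G ≡ G
  delete0-after-true []          _ = refl
  delete0-after-true (false ∷ G) _ = refl

  noConsec-true∷ : ∀ {n} (G : Subset n) → noConsec (true ∷ G) ≡ admissible G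
  noConsec-true∷ []          = refl
  noConsec-true∷ (false ∷ G) = refl
  noConsec-true∷ (true  ∷ G) = refl

  admissible⇒noConsec : ∀ {n} (G : Subset n) → admissible G ≡ true → noConsec G ≡ true
  admissible⇒noConsec []          _   = refl
  admissible⇒noConsec (false ∷ G) adm = adm

  admissible⇒noConsec-false∷ : ∀ {n} (G : Subset n) → admissible G ≡ true → noConsec (false ∷ G) ≡ true
  admissible⇒noConsec-false∷ []          _   = refl
  admissible⇒noConsec-false∷ (false ∷ G) adm = adm

  -- Signed words, descents and peaks

  signed : Bool → ℕ → ℤ
  signed b x = if b then -[1+ x ] else + suc x

  -- σ = (τ , s) is the word 0 , signed s₁ τ₁ , … , signed sₙ τₙ; this is the
  -- descent set of such a word with first letter v
  descentsFrom : ∀ {n} → ℤ → Vec ℕ n → Subset n → Subset n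
  descentsFrom v []       []       = []
  descentsFrom v (x ∷ xs) (b ∷ bs) = does (signed b x ℤ.<? v) ∷ descentsFrom (signed b x) xs bs

  -- entry k says whether the k-th letter of the word c , y₁ , … , yₙ is a
  -- peak; `up` says whether c itself was reached by an ascent
  peaksFrom : ∀ {n} → Bool → ℕ → Vec ℕ n → Subset n
  peaksFrom up c []       = []
  peaksFrom up c (y ∷ ys) = (up ∧ does (y <? c)) ∷ peaksFrom (does (c <? y)) y ys

  values : ∀ {n} → Permutation′ n → Vec ℕ n
  values τ = tabulate (toℕ ∘ (τ ⟨$⟩ʳ_))

  sval-suc : ∀ {n} (τ : Permutation′ n) (s : Subset n) (k : Fin n) →
             sval (τ , s) (suc (toℕ k)) ≡ signed (lookup s k) (toℕ (τ ⟨$⟩ʳ k))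
  sval-suc {n} τ s k with toℕ k <? n
  ... | yes k<n = cong (λ i → signed (lookup s i) (toℕ (τ ⟨$⟩ʳ i))) (fromℕ<-toℕ k k<n)
  ... | no  k≮n = ⊥-elim (k≮n (toℕ<n k))

  pval-suc : ∀ {n} (τ : Permutation′ n) (k : Fin n) → pval τ (suc (toℕ k)) ≡ suc (toℕ (τ ⟨$⟩ʳ k))
  pval-suc {n} τ k with toℕ k <? n
  ... | yes k<n = cong (λ i → suc (toℕ (τ ⟨$⟩ʳ i))) (fromℕ<-toℕ k k<n)
  ... | no  k≮n = ⊥-elim (k≮n (toℕ<n k))

  tabulate-descents : ∀ {n} (f : ℕ → ℤ) (xs : Vec ℕ n) (s : Subset n) →
                      (∀ k → f (suc (toℕ k)) ≡ signed (lookup s k) (lookup xs k)) →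
                      tabulate (λ k → does (f (suc (toℕ k)) ℤ.<? f (toℕ k))) ≡ descentsFrom (f 0) xs s
  tabulate-descents f []       []       _  = refl
  tabulate-descents f (x ∷ xs) (b ∷ bs) eq = cong₂ _∷_
    (cong (λ v → does (v ℤ.<? f 0)) (eq Fin.zero))
    (trans (tabulate-descents (f ∘ suc) xs bs (eq ∘ Fin.suc)) (cong (λ v → descentsFrom v xs bs) (eq Fin.zero)))

  Des-values : ∀ {n} (τ : Permutation′ n) (s : Subset n) → Des (τ , s) ≡ descentsFrom (+ 0) (values τ) s
  Des-values τ s = tabulate-descents (sval (τ , s)) (values τ) s λ k →
    trans (sval-suc τ s k) (cong (signed (lookup s k)) (sym (lookup∘tabulate _ k)))

  isPeakOf : (ℕ → ℕ) → Bool → ℕ → Bool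
  isPeakOf g up zero    = up ∧ does (g 1 <? g 0)
  isPeakOf g up (suc i) = does (g i <? g (suc i)) ∧ does (g (suc (suc i)) <? g (suc i))

  tabulate-isPeakOf : ∀ {n} (g : ℕ → ℕ) (up : Bool) →
                      tabulate {n = n} (isPeakOf g up ∘ toℕ) ≡ peaksFrom up (g 0) (tabulate (g ∘ suc ∘ toℕ))
  tabulate-isPeakOf {zero}  g up = refl
  tabulate-isPeakOf {suc n} g up = cong (up ∧ does (g 1 <? g 0) ∷_)
    (trans (tabulate-cong (shift ∘ toℕ)) (tabulate-isPeakOf (g ∘ suc) (does (g 0 <? g 1))))
    where
    shift : ∀ i → isPeakOf g up (suc i) ≡ isPeakOf (g ∘ suc) (does (g 0 <? g 1)) i
    shift zero    = refl
    shift (suc i) = refl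

  Peak-values : ∀ {n} (τ : Permutation′ n) → Peak τ ≡ peaksFrom false 0 (Vec.map suc (values τ))
  Peak-values {zero}  τ = refl
  Peak-values {suc n} τ = trans (tabulate-isPeakOf (pval τ) false)
    (cong (peaksFrom false 0) (trans (tabulate-cong (pval-suc τ)) (tabulate-∘ suc (toℕ ∘ (τ ⟨$⟩ʳ_)))))

  <?-asym : ∀ m n → (does (m <? n) ∧ does (n <? m)) ≡ false
  <?-asym m n with <-cmp m n
  ... | tri< m<n _ n≮m = trans (cong (_∧ does (n <? m)) (dec-true (m <? n) m<n)) (dec-false (n <? m) n≮m)
  ... | tri≈ m≮n _ _   = cong (_∧ does (n <? m)) (dec-false (m <? n) m≮n)
  ... | tri> m≮n _ _   = cong (_∧ does (n <? m)) (dec-false (m <? n) m≮n)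

  <?-flip : ∀ {m n} → m ≢ n → does (n <? m) ≡ not (does (m <? n))
  <?-flip {m} {n} m≢n with <-cmp m n
  ... | tri< m<n _ n≮m = trans (dec-false (n <? m) n≮m) (cong not (sym (dec-true (m <? n) m<n)))
  ... | tri≈ _ m≡n _   = ⊥-elim (m≢n m≡n)
  ... | tri> m≮n _ n<m = trans (dec-true (n <? m) n<m) (cong not (sym (dec-false (m <? n) m≮n)))

  peaksFrom-noConsec : ∀ {n} up c (ys : Vec ℕ n) → noConsec (peaksFrom up c ys) ≡ true
  peaksFrom-noConsec up c []            = refl
  peaksFrom-noConsec up c (y ∷ [])      = refl
  peaksFrom-noConsec up c (y ∷ y′ ∷ ys) = cong₂ _∧_
    (not-both up (does (y <? c)) (does (c <? y)) (does (y′ <? y)) (<?-asym y c))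
    (peaksFrom-noConsec (does (c <? y)) y (y′ ∷ ys))
    where
    not-both : ∀ u a b r → (a ∧ b) ≡ false → not ((u ∧ a) ∧ (b ∧ r)) ≡ true
    not-both false a     b     r _ = refl
    not-both true  false b     r _ = refl
    not-both true  true  false r _ = refl

  Peak-admissible : ∀ {n} (τ : Permutation′ n) → admissible (Peak τ) ≡ true
  Peak-admissible τ = trans (cong admissible (Peak-values τ)) (peaksFrom-admissible (Vec.map suc (values τ)))
    where
    peaksFrom-admissible : ∀ {n} (ys : Vec ℕ n) → admissible (peaksFrom false 0 ys) ≡ true
    peaksFrom-admissible []       = refl
    peaksFrom-admissible (y ∷ ys) = peaksFrom-noConsec false 0 (y ∷ ys)

  AdjacentDistinct : ∀ {n} → ℕ → Vec ℕ n → Set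
  AdjacentDistinct A []       = ⊤
  AdjacentDistinct A (x ∷ xs) = A ≢ suc x × AdjacentDistinct (suc x) xs

  values-adjacentDistinct : ∀ {n} (τ : Permutation′ n) → AdjacentDistinct 0 (values τ)
  values-adjacentDistinct {zero}  τ = tt
  values-adjacentDistinct {suc n} τ =
    (λ ()) , from-injective (toℕ ∘ (τ ⟨$⟩ʳ_)) (Injection.injective (↔⇒↣ τ) ∘ toℕ-injective)
    where
    from-injective : ∀ {n} (f : Fin (suc n) → ℕ) → Injective _≡_ _≡_ f →
                     AdjacentDistinct (suc (f Fin.zero)) (tabulate (f ∘ Fin.suc))
    from-injective {zero}  f inj = tt
    from-injective {suc n} f inj =
      0≢1+n ∘ inj ∘ suc-injective , from-injective (f ∘ Fin.suc) (FinP.suc-injective ∘ inj)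

  forcedDescent : ∀ {n} → ℕ → Vec ℕ n → Subset n → Bool
  forcedDescent A []       []      = false
  forcedDescent A (x ∷ xs) (j ∷ J) = not j ∧ does (suc x <? A)

  forcedDescent-0 : ∀ {n} (xs : Vec ℕ n) (J : Subset n) → forcedDescent 0 xs J ≡ false
  forcedDescent-0 []       []          = refl
  forcedDescent-0 (x ∷ xs) (false ∷ J) = refl
  forcedDescent-0 (x ∷ xs) (true  ∷ J) = refl

  peaksFrom-⊆-insert0 : ∀ {n} up c (xs : Vec ℕ n) (W : Subset n) →
    (peaksFrom up c (Vec.map suc xs) ⊆ₛ insert0 W) ≡ (peaksFrom false c (Vec.map suc xs) ⊆ₛ W)
  peaksFrom-⊆-insert0 up c []       [] = refl
  peaksFrom-⊆-insert0 up c (x ∷ xs) W  = ⊆ₛ-insert0 (peaksFrom up c (Vec.map suc (x ∷ xs))) W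

  peaksFrom-⊆-withNext : ∀ {n} up c (xs : Vec ℕ n) (J : Subset n) →
    (peaksFrom up c (Vec.map suc xs) ⊆ₛ withNext J)
      ≡ (not (up ∧ forcedDescent c xs J) ∧ (peaksFrom false c (Vec.map suc xs) ⊆ₛ withNext J))
  peaksFrom-⊆-withNext false c []       []      = refl
  peaksFrom-⊆-withNext true  c []       []      = refl
  peaksFrom-⊆-withNext up    c (x ∷ xs) (j ∷ J) = rearrange up j (does (suc x <? c)) _
    where
    rearrange : ∀ u j d R → ((not (u ∧ d) ∨ j) ∧ R) ≡ (not (u ∧ (not j ∧ d)) ∧ (true ∧ R))
    rearrange false j     d     R = refl
    rearrange true  false false R = refl
    rearrange true  false true  R = refl
    rearrange true  true  false R = refl
    rearrange true  true  true  R = refl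

  -- Permutations with prescribed descents and peaks

  tabulate-+ : ∀ {n} k → tabulate {n = n} (λ i → k + toℕ i) ≡ iterate suc k n
  tabulate-+ {zero}  k = refl
  tabulate-+ {suc n} k = cong₂ _∷_ (+-identityʳ k) (trans (tabulate-cong (λ i → +-suc k (toℕ i))) (tabulate-+ (suc k)))

  descentsFrom-iterate : ∀ {n} k b (s : Subset n) → descentsFrom (signed b k) (iterate suc (suc k) n) s ≡ s
  descentsFrom-iterate k b []       = refl
  descentsFrom-iterate k b (b′ ∷ s) = cong₂ _∷_ (head b b′) (descentsFrom-iterate (suc k) b′ s)
    where
    head : ∀ b b′ → does (signed b′ (suc k) ℤ.<? signed b k) ≡ b′
    head false false = dec-false (suc (suc k) <? suc k) (λ k+2<k+1 → <-asym k+2<k+1 (n<1+n (suc k)))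
    head true  false = refl
    head false true  = refl
    head true  true  = dec-true (k <? suc k) (n<1+n k)

  Des-id : ∀ {n} (s : Subset n) → Des (id , s) ≡ s
  Des-id s = trans (Des-values id s) (trans (cong (λ xs → descentsFrom (+ 0) xs s) (tabulate-+ 0)) (from-0 s))
    where
    from-0 : ∀ {n} (s : Subset n) → descentsFrom (+ 0) (iterate suc 0 n) s ≡ s
    from-0 []          = refl
    from-0 (false ∷ s) = cong (false ∷_) (descentsFrom-iterate 0 false s)
    from-0 (true  ∷ s) = cong (true ∷_) (descentsFrom-iterate 0 true s)

  peaksFrom-map-suc : ∀ {n} up c (ys : Vec ℕ n) → peaksFrom up (suc c) (Vec.map suc ys) ≡ peaksFrom up c ys
  peaksFrom-map-suc up c []       = refl
  peaksFrom-map-suc up c (y ∷ ys) = cong ((up ∧ does (y <? c)) ∷_) (peaksFrom-map-suc (does (c <? y)) y ys)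

  peaksFrom-true-0 : ∀ {n} (xs : Vec ℕ n) → peaksFrom true 0 (Vec.map suc xs) ≡ peaksFrom false 0 (Vec.map suc xs)
  peaksFrom-true-0 []       = refl
  peaksFrom-true-0 (x ∷ xs) = refl

  peaksFrom-0-map-suc : ∀ {n} (xs : Vec ℕ n) →
                        peaksFrom false 0 (Vec.map suc (Vec.map suc xs)) ≡ peaksFrom false 0 (Vec.map suc xs)
  peaksFrom-0-map-suc []       = refl
  peaksFrom-0-map-suc (x ∷ xs) = cong (false ∷_) (peaksFrom-map-suc true (suc x) (Vec.map suc xs))

  Peak-lift₀ : ∀ {m} (ρ : Permutation′ m) → Peak (lift₀ ρ) ≡ false ∷ Peak ρ
  Peak-lift₀ ρ = begin
    Peak (lift₀ ρ)
      ≡⟨ Peak-values (lift₀ ρ) ⟩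
    peaksFrom false 0 (Vec.map suc (0 ∷ tabulate (suc ∘ toℕ ∘ (ρ ⟨$⟩ʳ_))))
      ≡⟨ cong (λ vs → peaksFrom false 0 (Vec.map suc (0 ∷ vs))) (tabulate-∘ suc (toℕ ∘ (ρ ⟨$⟩ʳ_))) ⟩
    false ∷ peaksFrom true 1 (Vec.map suc (Vec.map suc (values ρ)))
      ≡⟨ cong (false ∷_) (trans (peaksFrom-map-suc true 0 _) (peaksFrom-true-0 (values ρ))) ⟩
    false ∷ peaksFrom false 0 (Vec.map suc (values ρ))
      ≡⟨ cong (false ∷_) (sym (Peak-values ρ)) ⟩
    false ∷ Peak ρ
      ∎
    where open ≡-Reasoning

  Peak-swap : ∀ {m} (ρ : Permutation′ m) → Peak (swap ρ) ≡ false ∷ true ∷ Peak ρ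
  Peak-swap ρ = begin
    Peak (swap ρ)
      ≡⟨ Peak-values (swap ρ) ⟩
    false ∷ true ∷ peaksFrom false 1 (Vec.map suc (tabulate (suc ∘ suc ∘ toℕ ∘ (ρ ⟨$⟩ʳ_))))
      ≡⟨ cong (λ vs → false ∷ true ∷ peaksFrom false 1 (Vec.map suc vs))
              (trans (tabulate-∘ suc _) (cong (Vec.map suc) (tabulate-∘ suc _))) ⟩
    false ∷ true ∷ peaksFrom false 1 (Vec.map suc (Vec.map suc (Vec.map suc (values ρ))))
      ≡⟨ cong (λ G → false ∷ true ∷ G) (trans (peaksFrom-map-suc false 0 _) (peaksFrom-0-map-suc (values ρ))) ⟩
    false ∷ true ∷ peaksFrom false 0 (Vec.map suc (values ρ))
      ≡⟨ cong (λ G → false ∷ true ∷ G) (sym (Peak-values ρ)) ⟩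
    false ∷ true ∷ Peak ρ
      ∎
    where open ≡-Reasoning

  -- built from leading blocks 1 (lift₀) and 2 1 (swap), the latter creating a peak
  permWithPeaks : ∀ {m} → Subset m → Permutation′ m
  permWithPeaks []                  = id
  permWithPeaks (_ ∷ [])            = id
  permWithPeaks (_ ∷ G@(false ∷ _)) = lift₀ (permWithPeaks G)
  permWithPeaks (_ ∷ true ∷ G)      = swap (permWithPeaks G)

  Peak-permWithPeaks : ∀ {m} (G : Subset m) → admissible G ≡ true → Peak (permWithPeaks G) ≡ G
  Peak-permWithPeaks []                  _   = refl
  Peak-permWithPeaks (false ∷ [])        _   = refl
  Peak-permWithPeaks (false ∷ false ∷ G) adm =
    trans (Peak-lift₀ (permWithPeaks (false ∷ G))) (cong (false ∷_) (Peak-permWithPeaks (false ∷ G) adm))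
  Peak-permWithPeaks (false ∷ true ∷ G)  adm =
    trans (Peak-swap (permWithPeaks G))
          (cong (λ H → false ∷ true ∷ H) (Peak-permWithPeaks G (trans (sym (noConsec-true∷ G)) adm)))

open Combinatorics

module Sums {c ℓ} (F : Field c ℓ) where
  open Field F
  open WithField F
  open import Algebra.Properties.CommutativeSemigroup +-commutativeSemigroup using (interchange)

  if-cong : ∀ b {x y : Carrier} → x ≈ y → (if b then x else 0#) ≈ (if b then y else 0#)
  if-cong false _   = refl
  if-cong true  x≈y = x≈y

  if-zero : ∀ b {x : Carrier} → x ≈ 0# → (if b then x else 0#) ≈ 0#
  if-zero false _   = refl
  if-zero true  x≈0 = x≈0

  if-+ : ∀ b (x y : Carrier) → (if b then x + y else 0#) ≈ (if b then x else 0#) + (if b then y else 0#)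
  if-+ false x y = sym (+-identityʳ 0#)
  if-+ true  x y = refl

  *-if : ∀ b (k x : Carrier) → k * (if b then x else 0#) ≈ (if b then k * x else 0#)
  *-if false k x = zeroʳ k
  *-if true  k x = refl

  if-∧ : ∀ p q (x : Carrier) → (if p ∧ q then x else 0#) ≡ (if q then (if p then x else 0#) else 0#)
  if-∧ false false x = ≡.refl
  if-∧ false true  x = ≡.refl
  if-∧ true  q     x = ≡.refl

  sumL-cong : ∀ {A : Set} (xs : List A) {f g : A → Carrier} → (∀ a → f a ≈ g a) → sumL xs f ≈ sumL xs g
  sumL-cong []       f≈g = refl
  sumL-cong (x ∷ xs) f≈g = +-cong (f≈g x) (sumL-cong xs f≈g)

  sumL-zero : ∀ {A : Set} (xs : List A) {f : A → Carrier} → (∀ a → f a ≈ 0#) → sumL xs f ≈ 0#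
  sumL-zero []       f≈0 = refl
  sumL-zero (x ∷ xs) f≈0 = trans (+-cong (f≈0 x) (sumL-zero xs f≈0)) (+-identityʳ 0#)

  sumL-++ : ∀ {A : Set} (xs ys : List A) (f : A → Carrier) → sumL (xs ++ ys) f ≈ sumL xs f + sumL ys f
  sumL-++ []       ys f = sym (+-identityˡ _)
  sumL-++ (x ∷ xs) ys f = trans (+-cong refl (sumL-++ xs ys f)) (sym (+-assoc _ _ _))

  sumL-map : ∀ {A B : Set} (g : A → B) (xs : List A) (f : B → Carrier) → sumL (List.map g xs) f ≡ sumL xs (f ∘ g)
  sumL-map g []       f = ≡.refl
  sumL-map g (x ∷ xs) f = ≡.cong (λ s → f (g x) + s) (sumL-map g xs f)

  sumL-+ : ∀ {A : Set} (xs : List A) (f g : A → Carrier) → sumL xs (λ a → f a + g a) ≈ sumL xs f + sumL xs g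
  sumL-+ []       f g = sym (+-identityʳ 0#)
  sumL-+ (x ∷ xs) f g = trans (+-cong refl (sumL-+ xs f g)) (interchange _ _ _ _)

  *-sumL : ∀ {A : Set} (xs : List A) (k : Carrier) (f : A → Carrier) → k * sumL xs f ≈ sumL xs (λ a → k * f a)
  *-sumL []       k f = zeroʳ k
  *-sumL (x ∷ xs) k f = trans (distribˡ k _ _) (+-cong refl (*-sumL xs k f))

  sumL-swap : ∀ {A B : Set} (xs : List A) (ys : List B) (f : A → B → Carrier) →
              sumL xs (λ a → sumL ys (f a)) ≈ sumL ys (λ b → sumL xs (λ a → f a b))
  sumL-swap []       ys f = sym (sumL-zero ys (λ _ → refl))
  sumL-swap (x ∷ xs) ys f = trans (+-cong refl (sumL-swap xs ys f)) (sym (sumL-+ ys (f x) _))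

  sumL-allSubsets-suc : ∀ n (f : Subset (suc n) → Carrier) →
    sumL (allSubsets (suc n)) f ≈ sumL (allSubsets n) (f ∘ (false ∷_)) + sumL (allSubsets n) (f ∘ (true ∷_))
  sumL-allSubsets-suc n f = trans (sumL-++ (List.map (false ∷_) (allSubsets n)) _ f)
    (+-cong (reflexive (sumL-map (false ∷_) (allSubsets n) f)) (reflexive (sumL-map (true ∷_) (allSubsets n) f)))

  sumL-≟ₛ : ∀ n (H : Subset n) (f : Subset n → Carrier) → sumL (allSubsets n) (λ G → if G ≟ₛ H then f G else 0#) ≈ f H
  sumL-≟ₛ zero    []          f = +-identityʳ _
  sumL-≟ₛ (suc n) (false ∷ H) f = trans (sumL-allSubsets-suc n _)
    (trans (+-cong (sumL-≟ₛ n H (f ∘ (false ∷_))) (sumL-zero (allSubsets n) (λ _ → refl))) (+-identityʳ _))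
  sumL-≟ₛ (suc n) (true  ∷ H) f = trans (sumL-allSubsets-suc n _)
    (trans (+-cong (sumL-zero (allSubsets n) (λ _ → refl)) (sumL-≟ₛ n H (f ∘ (true ∷_)))) (+-identityˡ _))

  sumL-select : ∀ n (p : Subset n → Bool) (H : Subset n) (f : Subset n → Carrier) →
    sumL (allSubsets n) (λ G → if p G ∧ (G ≟ₛ H) then f G else 0#) ≈ (if p H then f H else 0#)
  sumL-select n p H f = trans (sumL-cong (allSubsets n) (λ G → reflexive (if-∧ (p G) (G ≟ₛ H) (f G))))
                              (sumL-≟ₛ n H (λ G → if p G then f G else 0#))

module SignCounting {c ℓ} (F : Field c ℓ) where
  open Field F
  open WithField F
  open Sums F
  open import Relation.Binary.Reasoning.Setoid setoid
  open import Data.Bool.Properties using (∨-zeroʳ)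

  two : Carrier
  two = 1# + 1#

  2^∣_∣ : ∀ {n} → Subset n → Carrier
  2^∣ []        ∣ = 1#
  2^∣ false ∷ J ∣ = 2^∣ J ∣
  2^∣ true  ∷ J ∣ = 2^∣ J ∣ * two

  signCount : ∀ {n} → ℤ → Vec ℕ n → Subset n → Carrier
  signCount {n} v xs J = sumL (allSubsets n) λ s → if descentsFrom v xs s ⊆ₛ J then 1# else 0#

  signCount-step : ∀ {n} v x (xs : Vec ℕ n) j J →
    signCount v (x ∷ xs) (j ∷ J)
      ≈ (if not (does (signed false x ℤ.<? v)) ∨ j then signCount (signed false x) xs J else 0#)
      + (if not (does (signed true  x ℤ.<? v)) ∨ j then signCount (signed true  x) xs J else 0#)
  signCount-step {n} v x xs j J = trans (sumL-allSubsets-suc n _) (+-cong (first-sign false) (first-sign true))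
    where
    first-sign : ∀ b →
      sumL (allSubsets n) (λ s → if (not (does (signed b x ℤ.<? v)) ∨ j) ∧ (descentsFrom (signed b x) xs s ⊆ₛ J)
                                 then 1# else 0#)
        ≈ (if not (does (signed b x ℤ.<? v)) ∨ j then signCount (signed b x) xs J else 0#)
    first-sign b with not (does (signed b x ℤ.<? v)) ∨ j
    ... | false = sumL-zero (allSubsets n) (λ _ → refl)
    ... | true  = refl

  signCount-in-J : ∀ {n} v x (xs : Vec ℕ n) J →
    signCount v (x ∷ xs) (true ∷ J) ≈ signCount (+ suc x) xs J + signCount -[1+ x ] xs J
  signCount-in-J v x xs J = trans (signCount-step v x xs true J)
    (reflexive (≡.cong₂ (λ p q → (if p then signCount (+ suc x) xs J else 0#) + (if q then signCount -[1+ x ] xs J else 0#))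
                        (∨-zeroʳ _) (∨-zeroʳ _)))

  carry : ℤ → Bool → Carrier
  carry (+ _)    d = if d then 0# else 1#
  carry -[1+ _ ] d = if d then two else 1#

  module _ {P d : Bool} {u C⁺ C⁻ : Carrier}
           (C⁺≈ : C⁺ ≈ (if P then u * carry (+ 0) d else 0#))
           (C⁻≈ : C⁻ ≈ (if P then u * carry -[1+ 0 ] d else 0#)) where

    both-signs : C⁺ + C⁻ ≈ (if P then u * two else 0#)
    both-signs = begin
      C⁺ + C⁻
        ≈⟨ +-cong C⁺≈ C⁻≈ ⟩
      (if P then u * carry (+ 0) d else 0#) + (if P then u * carry -[1+ 0 ] d else 0#)
        ≈⟨ sym (if-+ P _ _) ⟩
      (if P then u * carry (+ 0) d + u * carry -[1+ 0 ] d else 0#)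
        ≈⟨ if-cong P (trans (sym (distribˡ u _ _)) (*-cong refl (carries-sum d))) ⟩
      (if P then u * two else 0#) ∎
      where
      carries-sum : ∀ d → carry (+ 0) d + carry -[1+ 0 ] d ≈ two
      carries-sum false = refl
      carries-sum true  = +-identityˡ two

    positive-only : C⁺ ≈ (if not d ∧ P then u * 1# else 0#)
    positive-only = trans C⁺≈ (drop d)
      where
      drop : ∀ d → (if P then u * carry (+ 0) d else 0#) ≈ (if not d ∧ P then u * 1# else 0#)
      drop false = refl
      drop true  = if-zero P (zeroʳ u)

    no-descent-after-positive : ∀ lt asc → lt ≡ not asc →
      (if not lt ∨ false then C⁺ else 0#) + 0# ≈ (if not (asc ∧ d) ∧ P then u * (if lt then 0# else 1#) else 0#)
    no-descent-after-positive false true  _ = trans (+-identityʳ C⁺) positive-only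
    no-descent-after-positive true  false _ = trans (+-identityʳ 0#) (sym (if-zero P (zeroʳ u)))

    no-descent-after-negative : ∀ lt asc → lt ≡ not asc →
      C⁺ + (if not asc ∨ false then C⁻ else 0#) ≈ (if not (asc ∧ d) ∧ P then u * (if lt then two else 1#) else 0#)
    no-descent-after-negative false true  _ = trans (+-identityʳ C⁺) positive-only
    no-descent-after-negative true  false _ = both-signs

  -- If position 0 lies outside J and the word descends there, no signing
  -- survives after a positive v, whereas after a negative v that position
  -- allows both signs of the next letter.
  signCount-formula : ∀ {n} (v : ℤ) (xs : Vec ℕ n) (J : Subset n) → AdjacentDistinct ∣ v ∣ xs →
    signCount v xs J ≈ (if peaksFrom false ∣ v ∣ (Vec.map suc xs) ⊆ₛ withNext J
                        then 2^∣ J ∣ * carry v (forcedDescent ∣ v ∣ xs J) else 0#)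
  signCount-formula (+ _)    []       []          _         = trans (+-identityʳ 1#) (sym (*-identityʳ 1#))
  signCount-formula -[1+ _ ] []       []          _         = trans (+-identityʳ 1#) (sym (*-identityʳ 1#))
  signCount-formula v        (x ∷ xs) (true ∷ J)  (_ , adj) = begin
    signCount v (x ∷ xs) (true ∷ J)
      ≈⟨ signCount-in-J v x xs J ⟩
    signCount (+ suc x) xs J + signCount -[1+ x ] xs J
      ≈⟨ both-signs (signCount-formula (+ suc x) xs J adj) (signCount-formula -[1+ x ] xs J adj) ⟩
    (if P then 2^∣ J ∣ * two else 0#)
      ≈⟨ if-cong P (sym (*-identityʳ _)) ⟩
    (if P then 2^∣ true ∷ J ∣ * 1# else 0#)
      ≡⟨ ≡.cong₂ (λ Q c → if Q then 2^∣ true ∷ J ∣ * c else 0#)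
                 (≡.sym (peaksFrom-⊆-insert0 _ (suc x) xs (withNext J))) (≡.sym (carry-false v)) ⟩
    (if peaksFrom false ∣ v ∣ (Vec.map suc (x ∷ xs)) ⊆ₛ withNext (true ∷ J)
     then 2^∣ true ∷ J ∣ * carry v false else 0#) ∎
    where
    P = peaksFrom false (suc x) (Vec.map suc xs) ⊆ₛ withNext J
    carry-false : ∀ v → carry v false ≡ 1#
    carry-false (+ _)    = ≡.refl
    carry-false -[1+ _ ] = ≡.refl
  signCount-formula (+ _)    (x ∷ xs) (false ∷ J) (A≢ , adj) = trans (signCount-step _ x xs false J)
    (trans (no-descent-after-positive (signCount-formula (+ suc x) xs J adj) (signCount-formula -[1+ x ] xs J adj)
                                      _ _ (<?-flip A≢))
           (reflexive (≡.cong (λ Q → if Q then _ else 0#) (≡.sym (peaksFrom-⊆-withNext _ (suc x) xs J)))))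
  signCount-formula -[1+ _ ] (x ∷ xs) (false ∷ J) (A≢ , adj) = trans (signCount-step _ x xs false J)
    (trans (no-descent-after-negative (signCount-formula (+ suc x) xs J adj) (signCount-formula -[1+ x ] xs J adj)
                                      _ _ (<?-flip A≢))
           (reflexive (≡.cong (λ Q → if Q then _ else 0#) (≡.sym (peaksFrom-⊆-withNext _ (suc x) xs J)))))

  countSignings : ∀ {n} (τ : Permutation′ n) (J : Subset n) →
    sumL (allSubsets n) (λ s → if Des (τ , s) ⊆ₛ J then 1# else 0#) ≈ (if Peak τ ⊆ₛ withNext J then 2^∣ J ∣ else 0#)
  countSignings {n} τ J = begin
    sumL (allSubsets n) (λ s → if Des (τ , s) ⊆ₛ J then 1# else 0#)
      ≈⟨ sumL-cong (allSubsets n) (λ s → reflexive (≡.cong (λ D → if D ⊆ₛ J then 1# else 0#) (Des-values τ s))) ⟩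
    signCount (+ 0) (values τ) J
      ≈⟨ signCount-formula (+ 0) (values τ) J (values-adjacentDistinct τ) ⟩
    (if peaksFrom false 0 (Vec.map suc (values τ)) ⊆ₛ withNext J
     then 2^∣ J ∣ * carry (+ 0) (forcedDescent 0 (values τ) J) else 0#)
      ≡⟨ ≡.cong₂ (λ Q d → if Q ⊆ₛ withNext J then 2^∣ J ∣ * carry (+ 0) d else 0#)
                 (≡.sym (Peak-values τ)) (forcedDescent-0 (values τ) J) ⟩
    (if Peak τ ⊆ₛ withNext J then 2^∣ J ∣ * 1# else 0#)
      ≈⟨ if-cong (Peak τ ⊆ₛ withNext J) (*-identityʳ _) ⟩
    (if Peak τ ⊆ₛ withNext J then 2^∣ J ∣ else 0#) ∎

module Coordinates {c ℓ} (F : Field c ℓ) where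
  open Field F
  open WithField F
  open Sums F
  open SignCounting F
  open import Relation.Binary.Reasoning.Setoid setoid
  open import Data.Bool.Properties using (∨-zeroʳ)
  open import Algebra.Properties.Ring ring using (-‿+-comm; -‿involutive)
  open import Algebra.Properties.Group +-group using (x∙y⁻¹≈ε⇒x≈y; //-rightDividesʳ)
  open import Algebra.Properties.CommutativeSemigroup +-commutativeSemigroup using (interchange)

  infix 4 _≋_ _≋ₐ_

  _≋_ : ∀ {m} → Coef m → Coef m → Set ℓ
  x ≋ y = ∀ J → x J ≈ y J

  -- the coefficients of an element of 𝔓 at non-admissible sets are irrelevant
  _≋ₐ_ : ∀ {m} → Coef m → Coef m → Set ℓ
  x ≋ₐ y = ∀ G → admissible G ≡ true → x G ≈ y G

  0ᶜ : ∀ {m} → Coef m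
  0ᶜ _ = 0#

  -- the coefficients of φ(Σ_J x_J X_J) in the basis (P_G)
  φcoef : (n : ℕ) → Coef n → Coef n
  φcoef n x G = sumL (allSubsets n) λ J → if G ⊆ₛ withNext J then 2^∣ J ∣ * x J else 0#

  φ-elemB : ∀ n (x : Coef n) τ → φ n (elemB n x) τ ≈ φcoef n x (Peak τ)
  φ-elemB n x τ = begin
    sumL (allSubsets n) (λ s → sumL (allSubsets n) (λ J → if Des (τ , s) ⊆ₛ J then x J else 0#))
      ≈⟨ sumL-swap (allSubsets n) (allSubsets n) _ ⟩
    sumL (allSubsets n) (λ J → sumL (allSubsets n) (λ s → if Des (τ , s) ⊆ₛ J then x J else 0#))
      ≈⟨ sumL-cong (allSubsets n) lifts-of-τ ⟩
    φcoef n x (Peak τ) ∎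
    where
    lifts-of-τ : ∀ J → sumL (allSubsets n) (λ s → if Des (τ , s) ⊆ₛ J then x J else 0#)
                       ≈ (if Peak τ ⊆ₛ withNext J then 2^∣ J ∣ * x J else 0#)
    lifts-of-τ J = begin
      sumL (allSubsets n) (λ s → if Des (τ , s) ⊆ₛ J then x J else 0#)
        ≈⟨ sumL-cong (allSubsets n) (λ s → sym (trans (*-if (Des (τ , s) ⊆ₛ J) (x J) 1#) (if-cong _ (*-identityʳ (x J))))) ⟩
      sumL (allSubsets n) (λ s → x J * (if Des (τ , s) ⊆ₛ J then 1# else 0#))
        ≈⟨ sym (*-sumL (allSubsets n) (x J) _) ⟩
      x J * sumL (allSubsets n) (λ s → if Des (τ , s) ⊆ₛ J then 1# else 0#)
        ≈⟨ *-cong refl (countSignings τ J) ⟩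
      x J * (if Peak τ ⊆ₛ withNext J then 2^∣ J ∣ else 0#)
        ≈⟨ trans (*-if (Peak τ ⊆ₛ withNext J) (x J) _) (if-cong _ (*-comm (x J) _)) ⟩
      (if Peak τ ⊆ₛ withNext J then 2^∣ J ∣ * x J else 0#) ∎

  elemP-Peak : ∀ n (d : Coef n) τ → elemP n d τ ≈ d (Peak τ)
  elemP-Peak n d τ = begin
    elemP n d τ
      ≈⟨ sumL-cong (allSubsets n) (λ G → reflexive (≡.cong (λ b → if admissible G ∧ b then d G else 0#) (≟ₛ-sym (Peak τ) G))) ⟩
    sumL (allSubsets n) (λ G → if admissible G ∧ (G ≟ₛ Peak τ) then d G else 0#)
      ≈⟨ sumL-select n admissible (Peak τ) d ⟩
    (if admissible (Peak τ) then d (Peak τ) else 0#)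
      ≡⟨ ≡.cong (λ b → if b then d (Peak τ) else 0#) (Peak-admissible τ) ⟩
    d (Peak τ) ∎

  φ-elemB≈elemP-φcoef : ∀ n (x : Coef n) τ → φ n (elemB n x) τ ≈ elemP n (φcoef n x) τ
  φ-elemB≈elemP-φcoef n x τ = trans (φ-elemB n x τ) (sym (elemP-Peak n (φcoef n x) τ))

  φcoef-cons : ∀ n (x : Coef (suc n)) g G →
    φcoef (suc n) x (g ∷ G) ≈ (if g then 0# else φcoef n (x ∘ (false ∷_)) G) + two * φcoef n (x ∘ (true ∷_)) (delete0 G)
  φcoef-cons n x g G = trans (sumL-allSubsets-suc n _) (+-cong (J∌0 g) J∋0)
    where
    J∌0 : ∀ g → sumL (allSubsets n) (λ J → if (g ∷ G) ⊆ₛ (false ∷ withNext J) then 2^∣ J ∣ * x (false ∷ J) else 0#)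
                ≈ (if g then 0# else φcoef n (x ∘ (false ∷_)) G)
    J∌0 false = refl
    J∌0 true  = sumL-zero (allSubsets n) (λ _ → refl)
    J∋0 : sumL (allSubsets n) (λ J → if (g ∷ G) ⊆ₛ (true ∷ insert0 (withNext J)) then (2^∣ J ∣ * two) * x (true ∷ J) else 0#)
          ≈ two * φcoef n (x ∘ (true ∷_)) (delete0 G)
    J∋0 = begin
      sumL (allSubsets n) (λ J → if (g ∷ G) ⊆ₛ (true ∷ insert0 (withNext J)) then (2^∣ J ∣ * two) * x (true ∷ J) else 0#)
        ≈⟨ sumL-cong (allSubsets n) (λ J → reflexive (≡.cong (λ b → if b then (2^∣ J ∣ * two) * x (true ∷ J) else 0#)
             (≡.trans (≡.cong (_∧ (G ⊆ₛ insert0 (withNext J))) (∨-zeroʳ (not g))) (⊆ₛ-insert0 G (withNext J))))) ⟩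
      sumL (allSubsets n) (λ J → if delete0 G ⊆ₛ withNext J then (2^∣ J ∣ * two) * x (true ∷ J) else 0#)
        ≈⟨ sumL-cong (allSubsets n) (λ J → trans (if-cong (delete0 G ⊆ₛ withNext J) (rearrange _ _ _)) (sym (*-if _ two _))) ⟩
      sumL (allSubsets n) (λ J → two * (if delete0 G ⊆ₛ withNext J then 2^∣ J ∣ * x (true ∷ J) else 0#))
        ≈⟨ sym (*-sumL (allSubsets n) two _) ⟩
      two * φcoef n (x ∘ (true ∷_)) (delete0 G) ∎
      where
      rearrange : ∀ a b c → (a * b) * c ≈ b * (a * c)
      rearrange a b c = trans (*-cong (*-comm a b) refl) (*-assoc b a c)

  φcoef-cong : ∀ n {x y : Coef n} → x ≋ y → φcoef n x ≋ φcoef n y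
  φcoef-cong n x≋y G = sumL-cong (allSubsets n) (λ J → if-cong (G ⊆ₛ withNext J) (*-cong refl (x≋y J)))

  φcoef-+ : ∀ n (x y : Coef n) G → φcoef n (λ J → x J + y J) G ≈ φcoef n x G + φcoef n y G
  φcoef-+ n x y G = trans
    (sumL-cong (allSubsets n) (λ J → trans (if-cong (G ⊆ₛ withNext J) (distribˡ _ (x J) (y J))) (if-+ (G ⊆ₛ withNext J) _ _)))
    (sumL-+ (allSubsets n) _ _)

  φcoef-0ᶜ : ∀ n → φcoef n 0ᶜ ≋ 0ᶜ
  φcoef-0ᶜ n G = sumL-zero (allSubsets n) (λ J → if-zero (G ⊆ₛ withNext J) (zeroʳ _))

  βcoef-head : ∀ m (x : Coef (suc m)) → βcoef m x ≋ x ∘ (false ∷_)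
  βcoef-head m x J = trans (sumL-allSubsets-suc m _)
    (trans (+-cong (sumL-≟ₛ m J (x ∘ (false ∷_))) (sumL-zero (allSubsets m) (λ _ → refl))) (+-identityʳ _))

  β² : ∀ m → Coef (suc (suc m)) → Coef m
  β² m x = βcoef m (βcoef (suc m) x)

  β²-head : ∀ m (x : Coef (suc (suc m))) → β² m x ≋ x ∘ (false ∷_) ∘ (false ∷_)
  β²-head m x J = trans (βcoef-head m (βcoef (suc m) x) J) (βcoef-head (suc m) x (false ∷ J))

  shift₂ : ∀ m → Coef m → Coef (suc (suc m))
  shift₂ m x (false ∷ false ∷ J) = x J
  shift₂ m x (false ∷ true  ∷ J) = 0#
  shift₂ m x (true  ∷ J)         = 0#

  πcoef-head : ∀ m (d : Coef (suc (suc m))) G → admissible G ≡ true →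
               πcoef m d G ≈ d (false ∷ false ∷ G) + - d (false ∷ true ∷ G)
  πcoef-head m d G adm = begin
    πcoef m d G
      ≈⟨ trans (sumL-allSubsets-suc (suc m) _)
               (trans (+-cong (sumL-allSubsets-suc m _) (sumL-zero (allSubsets (suc m)) (λ { (_ ∷ _) → refl })))
                      (+-identityʳ _)) ⟩
    sumL (allSubsets m) (λ R → if noConsec (false ∷ R) ∧ (R ≟ₛ G) then (if contains2 R then 0# else d (false ∷ false ∷ R)) else 0#)
      + sumL (allSubsets m) (λ R → if noConsec (true ∷ R) ∧ (R ≟ₛ G) then - d (false ∷ true ∷ R) else 0#)
      ≈⟨ +-cong (sumL-select m (noConsec ∘ (false ∷_)) G _) (sumL-select m (noConsec ∘ (true ∷_)) G _) ⟩
    (if noConsec (false ∷ G) then (if contains2 G then 0# else d (false ∷ false ∷ G)) else 0#)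
      + (if noConsec (true ∷ G) then - d (false ∷ true ∷ G) else 0#)
      ≈⟨ sparse G adm ⟩
    d (false ∷ false ∷ G) + - d (false ∷ true ∷ G) ∎
    where
    sparse : ∀ G → admissible G ≡ true →
      (if noConsec (false ∷ G) then (if contains2 G then 0# else d (false ∷ false ∷ G)) else 0#)
        + (if noConsec (true ∷ G) then - d (false ∷ true ∷ G) else 0#)
        ≈ d (false ∷ false ∷ G) + - d (false ∷ true ∷ G)
    sparse []          _   = refl
    sparse (false ∷ G) adm = reflexive (≡.cong (λ b → (if b then d (false ∷ false ∷ false ∷ G) else 0#)
                                                    + (if b then - d (false ∷ true ∷ false ∷ G) else 0#)) adm)

  πcoef-difference : ∀ m (a b : Coef (suc (suc m))) →
                     πcoef m (λ G → a G + - b G) ≋ₐ (λ G → πcoef m a G + - πcoef m b G)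
  πcoef-difference m a b G adm = begin
    πcoef m (λ G → a G + - b G) G
      ≈⟨ πcoef-head m _ G adm ⟩
    (a (false ∷ false ∷ G) + - b (false ∷ false ∷ G)) + - (a (false ∷ true ∷ G) + - b (false ∷ true ∷ G))
      ≈⟨ regroup _ _ _ _ ⟩
    (a (false ∷ false ∷ G) + - a (false ∷ true ∷ G)) + - (b (false ∷ false ∷ G) + - b (false ∷ true ∷ G))
      ≈⟨ sym (+-cong (πcoef-head m a G adm) (-‿cong (πcoef-head m b G adm))) ⟩
    πcoef m a G + - πcoef m b G ∎
    where
    negate-difference : ∀ u v → - (u + - v) ≈ - u + v
    negate-difference u v = trans (sym (-‿+-comm u (- v))) (+-cong refl (-‿involutive v))
    regroup : ∀ p q r s → (p + - q) + - (r + - s) ≈ (p + - r) + - (q + - s)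
    regroup p q r s = begin
      (p + - q) + - (r + - s) ≈⟨ +-cong refl (negate-difference r s) ⟩
      (p + - q) + (- r + s)   ≈⟨ interchange p (- q) (- r) s ⟩
      (p + - r) + (- q + s)   ≈⟨ +-cong refl (sym (negate-difference q s)) ⟩
      (p + - r) + - (q + - s) ∎

  πcoef≋0⇒ : ∀ m (d : Coef (suc (suc m))) → πcoef m d ≋ₐ 0ᶜ →
             ∀ G → admissible (false ∷ G) ≡ true → d (false ∷ delete0 G) ≈ d (false ∷ G)
  πcoef≋0⇒ m d πd≋0 (false ∷ G) _   = refl
  πcoef≋0⇒ m d πd≋0 (true  ∷ G) adm = x∙y⁻¹≈ε⇒x≈y _ _ (trans (sym (πcoef-head m d G G-adm)) (πd≋0 G G-adm))
    where
    G-adm : admissible G ≡ true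
    G-adm = ≡.trans (≡.sym (noConsec-true∷ G)) adm

  πcoef-φcoef : ∀ m (x : Coef (suc (suc m))) → πcoef m (φcoef (suc (suc m)) x) ≋ₐ φcoef m (β² m x)
  πcoef-φcoef m x G adm = begin
    πcoef m (φcoef (suc (suc m)) x) G
      ≈⟨ πcoef-head m _ G adm ⟩
    φcoef (suc (suc m)) x (false ∷ false ∷ G) + - φcoef (suc (suc m)) x (false ∷ true ∷ G)
      ≈⟨ +-cong (trans (φcoef-cons (suc m) x false (false ∷ G)) (+-cong (φcoef-cons m (x ∘ (false ∷_)) false G) refl))
                (-‿cong (trans (φcoef-cons (suc m) x false (true ∷ G)) (+-cong (φcoef-cons m (x ∘ (false ∷_)) true G) refl))) ⟩
    ((φcoef m x₀₀ G + t) + s) + - ((0# + t) + s)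
      ≈⟨ trans (+-cong (+-assoc _ t s) (-‿cong (+-cong (+-identityˡ t) refl))) (//-rightDividesʳ (t + s) _) ⟩
    φcoef m x₀₀ G
      ≈⟨ φcoef-cong m (λ J → sym (β²-head m x J)) G ⟩
    φcoef m (β² m x) G ∎
    where
    x₀₀ = x ∘ (false ∷_) ∘ (false ∷_)
    t = two * φcoef m (x ∘ (false ∷_) ∘ (true ∷_)) (delete0 G)
    s = two * φcoef (suc m) (x ∘ (true ∷_)) (false ∷ G)

module Filtrations {c ℓ} (F : Field c ℓ) where
  open Field F hiding (zero)
  open WithField F
  open Sums F
  open Coordinates F
  open import Relation.Binary.Reasoning.Setoid setoid

  superset-sums-zero⇒zero : ∀ n (x : Coef n) →
    (∀ s → sumL (allSubsets n) (λ J → if s ⊆ₛ J then x J else 0#) ≈ 0#) → x ≋ 0ᶜ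
  superset-sums-zero⇒zero zero    x sums≈0 [] = trans (sym (+-identityʳ _)) (sums≈0 [])
  superset-sums-zero⇒zero (suc n) x sums≈0 = λ { (false ∷ J) → x₀≋0 J ; (true ∷ J) → x₁≋0 J }
    where
    x₁≋0 : x ∘ (true ∷_) ≋ 0ᶜ
    x₁≋0 = superset-sums-zero⇒zero n _ λ s → begin
      sumL (allSubsets n) (λ J → if s ⊆ₛ J then x (true ∷ J) else 0#)
        ≈⟨ sym (trans (+-cong (sumL-zero (allSubsets n) (λ _ → refl)) refl) (+-identityˡ _)) ⟩
      sumL (allSubsets n) (λ J → 0#) + sumL (allSubsets n) (λ J → if s ⊆ₛ J then x (true ∷ J) else 0#)
        ≈⟨ trans (sym (sumL-allSubsets-suc n _)) (sums≈0 (true ∷ s)) ⟩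
      0# ∎
    x₀≋0 : x ∘ (false ∷_) ≋ 0ᶜ
    x₀≋0 = superset-sums-zero⇒zero n _ λ s → begin
      sumL (allSubsets n) (λ J → if s ⊆ₛ J then x (false ∷ J) else 0#)
        ≈⟨ sym (trans (+-cong refl (sumL-zero (allSubsets n) (λ J → if-zero (s ⊆ₛ J) (x₁≋0 J)))) (+-identityʳ _)) ⟩
      sumL (allSubsets n) (λ J → if s ⊆ₛ J then x (false ∷ J) else 0#)
        + sumL (allSubsets n) (λ J → if s ⊆ₛ J then x (true ∷ J) else 0#)
        ≈⟨ trans (sym (sumL-allSubsets-suc n _)) (sums≈0 (false ∷ s)) ⟩
      0# ∎

  elemB-injective : ∀ m (x : Coef m) → (∀ σ → elemB m x σ ≈ 0#) → x ≋ 0ᶜ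
  elemB-injective m x elemB≈0 = superset-sums-zero⇒zero m x λ s →
    trans (sumL-cong (allSubsets m) (λ J → reflexive (≡.cong (λ D → if D ⊆ₛ J then x J else 0#) (≡.sym (Des-id s)))))
          (elemB≈0 (id , s))

  elemP-injective : ∀ m (d : Coef m) → (∀ τ → elemP m d τ ≈ 0#) → d ≋ₐ 0ᶜ
  elemP-injective m d elemP≈0 G adm = begin
    d G                          ≡⟨ ≡.cong d (≡.sym (Peak-permWithPeaks G adm)) ⟩
    d (Peak (permWithPeaks G))   ≈⟨ sym (elemP-Peak m d (permWithPeaks G)) ⟩
    elemP m d (permWithPeaks G)  ≈⟨ elemP≈0 (permWithPeaks G) ⟩
    0#                           ∎

  elemP-cong : ∀ m {d d′ : Coef m} → d ≋ₐ d′ → ∀ τ → elemP m d τ ≈ elemP m d′ τ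
  elemP-cong m {d} {d′} d≋d′ τ =
    trans (elemP-Peak m d τ) (trans (d≋d′ (Peak τ) (Peak-admissible τ)) (sym (elemP-Peak m d′ τ)))

  βcoef-cong : ∀ m {x y : Coef (suc m)} → x ≋ y → βcoef m x ≋ βcoef m y
  βcoef-cong m {x} {y} x≋y J = trans (βcoef-head m x J) (trans (x≋y (false ∷ J)) (sym (βcoef-head m y J)))

  πcoef-cong : ∀ m {d d′ : Coef (suc (suc m))} → d ≋ₐ d′ → πcoef m d ≋ₐ πcoef m d′
  πcoef-cong m {d} {d′} d≋d′ G adm = begin
    πcoef m d G                                       ≈⟨ πcoef-head m d G adm ⟩
    d (false ∷ false ∷ G) + - d (false ∷ true ∷ G)    ≈⟨ +-cong (d≋d′ _ (admissible⇒noConsec-false∷ G adm))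
                                                                (-‿cong (d≋d′ _ (≡.trans (noConsec-true∷ G) adm))) ⟩
    d′ (false ∷ false ∷ G) + - d′ (false ∷ true ∷ G)  ≈⟨ sym (πcoef-head m d′ G adm) ⟩
    πcoef m d′ G                                      ∎

  killedB-cong : ∀ k m {x y : Coef m} → x ≋ y → killedB k m x → killedB k m y
  killedB-cong zero    m       x≋y x∈ σ = trans (sym (sumL-cong (allSubsets m) (λ J → if-cong (Des σ ⊆ₛ J) (x≋y J)))) (x∈ σ)
  killedB-cong (suc k) zero    _   x∈   = x∈
  killedB-cong (suc k) (suc m) x≋y x∈   = killedB-cong k m (βcoef-cong m x≋y) x∈

  killedP-cong : ∀ k m {d d′ : Coef m} → d ≋ₐ d′ → killedP k m d → killedP k m d′
  killedP-cong zero    m             d≋d′ d∈ τ = trans (sym (elemP-cong m d≋d′ τ)) (d∈ τ)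
  killedP-cong (suc k) zero          _    d∈   = d∈
  killedP-cong (suc k) (suc zero)    _    d∈   = d∈
  killedP-cong (suc k) (suc (suc m)) d≋d′ d∈   = killedP-cong k m (πcoef-cong m d≋d′) d∈

  killedB-0ᶜ : ∀ k m {x : Coef m} → x ≋ 0ᶜ → killedB k m x
  killedB-0ᶜ zero    m       x≋0 σ = sumL-zero (allSubsets m) (λ J → if-zero (Des σ ⊆ₛ J) (x≋0 J))
  killedB-0ᶜ (suc k) zero    _     = lift tt
  killedB-0ᶜ (suc k) (suc m) {x} x≋0 = killedB-0ᶜ k m (λ J → trans (βcoef-head m x J) (x≋0 (false ∷ J)))

  killedB-suc : ∀ k m {x : Coef m} → killedB k m x → killedB (suc k) m x
  killedB-suc zero    zero    _  = lift tt
  killedB-suc zero    (suc m) {x} x∈ =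
    killedB-0ᶜ zero m (λ J → trans (βcoef-head m x J) (elemB-injective (suc m) x x∈ (false ∷ J)))
  killedB-suc (suc k) zero    _  = lift tt
  killedB-suc (suc k) (suc m) x∈ = killedB-suc k m x∈

  φcoef-killed-by-π : ∀ m (x : Coef (suc (suc m))) → β² m x ≋ 0ᶜ → killedP 1 (suc (suc m)) (φcoef (suc (suc m)) x)
  φcoef-killed-by-π m x β²x≋0 τ =
    trans (elemP-cong m πφx≋0 τ) (sumL-zero (allSubsets m) (λ G → if-zero (admissible G ∧ (Peak τ ≟ₛ G)) refl))
    where
    πφx≋0 : πcoef m (φcoef (suc (suc m)) x) ≋ₐ 0ᶜ
    πφx≋0 G adm = trans (πcoef-φcoef m x G adm) (trans (φcoef-cong m β²x≋0 G) (φcoef-0ᶜ m G))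

  φcoef-killed : ∀ i m (x : Coef m) → killedB (suc i) m x → killedP (suc ⌊ i /2⌋) m (φcoef m x)
  φcoef-killed i             zero          x _  = lift tt
  φcoef-killed i             (suc zero)    x _  = lift tt
  φcoef-killed 0             (suc (suc m)) x x∈ = φcoef-killed 1 (suc (suc m)) x (killedB-suc 1 (suc (suc m)) x∈)
  φcoef-killed 1             (suc (suc m)) x x∈ = φcoef-killed-by-π m x (elemB-injective m (β² m x) x∈)
  φcoef-killed (suc (suc i)) (suc (suc m)) x x∈ =
    killedP-cong (suc ⌊ i /2⌋) m (λ G adm → sym (πcoef-φcoef m x G adm)) (φcoef-killed i m (β² m x) x∈)

IsHalf : ∀ {c ℓ} (F : Field c ℓ) → Field.Carrier F → Set ℓ
IsHalf F h = (1# + 1#) * h ≈ 1#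
  where open Field F

module Surjectivity {c ℓ} (F : Field c ℓ) (½ : Field.Carrier F) (two*½≈1 : IsHalf F ½) where
  open Field F hiding (zero)
  open WithField F
  open SignCounting F using (two)
  open Coordinates F
  open Filtrations F
  open import Relation.Binary.Reasoning.Setoid setoid
  open import Algebra.Properties.Group +-group using (//-rightDividesˡ)

  two*½*v≈v : ∀ v → two * (½ * v) ≈ v
  two*½*v≈v v = trans (sym (*-assoc two ½ v)) (trans (*-cong two*½≈1 refl) (*-identityˡ v))

  -- Solves φcoef m x ≈ t one leading bit at a time (see φcoef-cons): the
  -- coefficients at J ∋ 0 are read off t at sets containing 0, then those at
  -- J ∌ 0 off t at sets avoiding 0.
  φcoef⁻¹ : ∀ m → Coef m → Coef m
  φcoef⁻¹ zero    t []          = t []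
  φcoef⁻¹ (suc m) t (false ∷ K) = φcoef⁻¹ m (λ G → t (false ∷ G) + - t (true ∷ delete0 G)) K
  φcoef⁻¹ (suc m) t (true  ∷ K) = φcoef⁻¹ m (λ G → ½ * t (true ∷ delete0 G)) K

  φcoef-φcoef⁻¹ : ∀ m (t : Coef m) G → noConsec G ≡ true → φcoef m (φcoef⁻¹ m t) G ≈ t G
  φcoef-φcoef⁻¹ zero    t []          _  = trans (+-identityʳ _) (*-identityˡ _)
  φcoef-φcoef⁻¹ (suc m) t (true ∷ G)  nc = begin
    φcoef (suc m) (φcoef⁻¹ (suc m) t) (true ∷ G)
      ≈⟨ φcoef-cons m _ true G ⟩
    0# + two * φcoef m (φcoef⁻¹ m t₁) (delete0 G)
      ≈⟨ trans (+-identityˡ _) (*-cong refl (φcoef-φcoef⁻¹ m t₁ (delete0 G) (noConsec-delete0-tail true G nc))) ⟩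
    two * (½ * t (true ∷ delete0 (delete0 G)))
      ≈⟨ two*½*v≈v _ ⟩
    t (true ∷ delete0 (delete0 G))
      ≡⟨ ≡.cong (λ H → t (true ∷ H)) (≡.trans (delete0-idem G) (delete0-after-true G nc)) ⟩
    t (true ∷ G) ∎
    where
    t₁ = λ G → ½ * t (true ∷ delete0 G)
  φcoef-φcoef⁻¹ (suc m) t (false ∷ G) nc = begin
    φcoef (suc m) (φcoef⁻¹ (suc m) t) (false ∷ G)
      ≈⟨ φcoef-cons m _ false G ⟩
    φcoef m (φcoef⁻¹ m t₀) G + two * φcoef m (φcoef⁻¹ m t₁) (delete0 G)
      ≈⟨ +-cong (φcoef-φcoef⁻¹ m t₀ G (noConsec-tail false G nc))
                (*-cong refl (φcoef-φcoef⁻¹ m t₁ (delete0 G) (noConsec-delete0-tail false G nc))) ⟩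
    (t (false ∷ G) + - t (true ∷ delete0 G)) + two * (½ * t (true ∷ delete0 (delete0 G)))
      ≈⟨ +-cong refl (trans (two*½*v≈v _) (reflexive (≡.cong (λ H → t (true ∷ H)) (delete0-idem G)))) ⟩
    (t (false ∷ G) + - t (true ∷ delete0 G)) + t (true ∷ delete0 G)
      ≈⟨ //-rightDividesˡ _ _ ⟩
    t (false ∷ G) ∎
    where
    t₀ = λ G → t (false ∷ G) + - t (true ∷ delete0 G)
    t₁ = λ G → ½ * t (true ∷ delete0 G)

  φcoef-φcoef⁻¹-admissible : ∀ m (t : Coef m) → φcoef m (φcoef⁻¹ m t) ≋ₐ t
  φcoef-φcoef⁻¹-admissible m t G adm = φcoef-φcoef⁻¹ m t G (admissible⇒noConsec G adm)

  kerPreimage : ∀ m → Coef (suc m) → Coef (suc m)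
  kerPreimage m d (false ∷ K) = 0#
  kerPreimage m d (true  ∷ K) = φcoef⁻¹ m (λ H → ½ * d (false ∷ H)) K

  β-kerPreimage : ∀ m (d : Coef (suc m)) → βcoef m (kerPreimage m d) ≋ 0ᶜ
  β-kerPreimage m d = βcoef-head m (kerPreimage m d)

  φcoef-kerPreimage : ∀ m (d : Coef (suc m)) →
    (∀ G → admissible (false ∷ G) ≡ true → d (false ∷ delete0 G) ≈ d (false ∷ G)) →
    φcoef (suc m) (kerPreimage m d) ≋ₐ d
  φcoef-kerPreimage m d d-ignores-1 (false ∷ G) adm = begin
    φcoef (suc m) (kerPreimage m d) (false ∷ G)
      ≈⟨ φcoef-cons m _ false G ⟩
    φcoef m 0ᶜ G + two * φcoef m (φcoef⁻¹ m t) (delete0 G)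
      ≈⟨ +-cong (φcoef-0ᶜ m G) (*-cong refl (φcoef-φcoef⁻¹ m t (delete0 G) (noConsec-delete0-tail false G adm))) ⟩
    0# + two * (½ * d (false ∷ delete0 G))
      ≈⟨ trans (+-identityˡ _) (two*½*v≈v _) ⟩
    d (false ∷ delete0 G)
      ≈⟨ d-ignores-1 G adm ⟩
    d (false ∷ G) ∎
    where
    t = λ H → ½ * d (false ∷ H)

  φcoef-onto-ker : ∀ m (y : Coef m) → killedP 1 m y → ∃ λ x → killedB 1 m x × φcoef m x ≋ₐ y
  φcoef-onto-ker zero          y _  = φcoef⁻¹ zero y , lift tt , φcoef-φcoef⁻¹-admissible zero y
  φcoef-onto-ker (suc zero)    y _  =
    kerPreimage zero y , killedB-0ᶜ zero zero (β-kerPreimage zero y) , φcoef-kerPreimage zero y (λ { [] _ → refl })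
  φcoef-onto-ker (suc (suc m)) y y∈ =
    kerPreimage (suc m) y , killedB-0ᶜ zero (suc m) (β-kerPreimage (suc m) y) ,
    φcoef-kerPreimage (suc m) y (πcoef≋0⇒ m y (elemP-injective m (πcoef m y) y∈))

  -- A preimage of π y, shifted by two, leaves a defect in ker π.
  preimage-from-π : ∀ i m (y : Coef (suc (suc m))) →
    (∃ λ x′ → killedB (suc i) m x′ × φcoef m x′ ≋ₐ πcoef m y) →
    ∃ λ x → killedB (suc (suc (suc i))) (suc (suc m)) x × φcoef (suc (suc m)) x ≋ₐ y
  preimage-from-π i m y (x′ , x′∈ , φx′≋πy) = x , x∈ , φx≋y
    where
    M = suc (suc m)
    x₀ : Coef M
    x₀ = shift₂ m x′
    d : Coef M
    d G = y G + - φcoef M x₀ G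
    πd≋0 : πcoef m d ≋ₐ 0ᶜ
    πd≋0 G adm = begin
      πcoef m d G                             ≈⟨ πcoef-difference m y _ G adm ⟩
      πcoef m y G + - πcoef m (φcoef M x₀) G  ≈⟨ +-cong refl (-‿cong (πcoef-φcoef m x₀ G adm)) ⟩
      πcoef m y G + - φcoef m (β² m x₀) G     ≈⟨ +-cong refl (-‿cong (φcoef-cong m (β²-head m x₀) G)) ⟩
      πcoef m y G + - φcoef m x′ G            ≈⟨ +-cong refl (-‿cong (φx′≋πy G adm)) ⟩
      πcoef m y G + - πcoef m y G             ≈⟨ -‿inverseʳ _ ⟩
      0#                                      ∎
    x : Coef M
    x J = x₀ J + kerPreimage (suc m) d J
    x∈ : killedB (suc (suc (suc i))) M x
    x∈ = killedB-cong (suc i) m (λ J → sym (trans (β²-head m x J) (+-identityʳ _))) x′∈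
    φx≋y : φcoef M x ≋ₐ y
    φx≋y G adm = begin
      φcoef M x G                                   ≈⟨ φcoef-+ M _ _ G ⟩
      φcoef M x₀ G + φcoef M (kerPreimage (suc m) d) G
        ≈⟨ +-cong refl (φcoef-kerPreimage (suc m) d (πcoef≋0⇒ m d πd≋0) G adm) ⟩
      φcoef M x₀ G + (y G + - φcoef M x₀ G)         ≈⟨ trans (+-comm _ _) (//-rightDividesˡ _ _) ⟩
      y G                                           ∎

  φcoef-onto-killed : ∀ i m (y : Coef m) → killedP (suc ⌊ i /2⌋) m y → ∃ λ x → killedB (suc i) m x × φcoef m x ≋ₐ y
  φcoef-onto-killed 0             m             y y∈ = φcoef-onto-ker m y y∈
  φcoef-onto-killed 1             m             y y∈ =
    let x , x∈ , φx≋y = φcoef-onto-ker m y y∈ in x , killedB-suc 1 m x∈ , φx≋y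
  φcoef-onto-killed (suc (suc i)) zero          y _  = φcoef⁻¹ zero y , lift tt , φcoef-φcoef⁻¹-admissible zero y
  φcoef-onto-killed (suc (suc i)) (suc zero)    y _  = φcoef⁻¹ 1 y , lift tt , φcoef-φcoef⁻¹-admissible 1 y
  φcoef-onto-killed (suc (suc i)) (suc (suc m)) y y∈ = preimage-from-π i m y (φcoef-onto-killed i m (πcoef m y) y∈)

proposition3p6 : ∀ {c ℓ} (F : Field c ℓ) → CharNot2 F →
    ∀ (n i : ℕ) → i ≤ n →
    let open Field F
        open WithField F
    in ((x : Coef n) → In𝔍 n i x →
          ∃ λ y → In𝔓 n ⌊ i /2⌋ y × (∀ τ → φ n (elemB n x) τ ≈ elemP n y τ))
     × ((y : Coef n) → In𝔓 n ⌊ i /2⌋ y →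
          ∃ λ x → In𝔍 n i x × (∀ τ → φ n (elemB n x) τ ≈ elemP n y τ))
proposition3p6 F char≢2 n i _ = image-⊆ , image-⊇
  where
  open Field F
  open WithField F
  open Coordinates F
  open Filtrations F
  open Surjectivity F (proj₁ (inverse (1# + 1#) char≢2)) (proj₂ (inverse (1# + 1#) char≢2))

  image-⊆ : (x : Coef n) → In𝔍 n i x → ∃ λ y → In𝔓 n ⌊ i /2⌋ y × (∀ τ → φ n (elemB n x) τ ≈ elemP n y τ)
  image-⊆ x x∈ = φcoef n x , φcoef-killed i n x x∈ , φ-elemB≈elemP-φcoef n x

  image-⊇ : (y : Coef n) → In𝔓 n ⌊ i /2⌋ y → ∃ λ x → In𝔍 n i x × (∀ τ → φ n (elemB n x) τ ≈ elemP n y τ)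
  image-⊇ y y∈ =
    let x , x∈ , φx≋y = φcoef-onto-killed i n y y∈
    in  x , x∈ , λ τ → trans (φ-elemB≈elemP-φcoef n x τ) (elemP-cong n φx≋y τ)
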